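{- Let $A$ be a set, $R$ a binary relation on $A$, $\Delta\in A$, $(\mathrm{con}_i)_{i\in A}$ a family of sets of finite subsets of $A$, and $(\vdash_i)_{i\in A}$ a family of relations $\vdash_i\subseteq\mathrm{con}_i\times A$. Write $X\vdash_i Y$ if $X\vdash_i b$ for all $b\in Y$. Assume that for all $i,j,a\in A$ and finite $X,Y\subseteq A$ the following hold: (A4) if $X\in\mathrm{con}_i$ and $X\vdash_i Y$, then $Y\in\mathrm{con}_i$; (A5) if $X,Y\in\mathrm{con}_i$, $Y\supseteq X$ and $X\vdash_i a$, then $Y\vdash_i a$; (A8) if $iRj$, then $\mathrm{con}_i\subseteq\mathrm{con}_j$; (A9) if $\{i\}\in\mathrm{con}_j$, then $iRj$; (A10) if $iRj$, $X\in\mathrm{con}_i$ and $X\vdash_i a$, then $X\vdash_j a$; (A11) if $iRj$, $X\in\mathrm{con}_i$ and $X\vdash_j a$, then $X\vdash_i a$. Then the following two statements are equivalent. (I) Both of these conditions hold for all $i,a\in A$ and finite $X,Y$: (A7) if $X\in\mathrm{con}_i$ and $X\vdash_i a$, then there is $Z\in\mathrm{con}_i$ with $X\vdash_i Z$ and $Z\vdash_i a$; (A12) if $X\vdash_i Y$, then there is $e\in A$ with $X\vdash_i e$ and $Y\in\mathrm{con}_e$. (II) For all $i\in A$, $X\in\mathrm{con}_i$ and finite $F\subseteq A$, if $X\vdash_i F$, then there are $j\in A$ and $Y\in\mathrm{con}_j$ such that $X\vdash_i j$, $X\vdash_i Y$ and $Y\vdash_j F$. -}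

module Defs where

open import Data.List using (List; _∷_; [])
open import Data.List.Membership.Propositional using (_∈_)
open import Data.List.Relation.Unary.All using (All)
open import Data.List.Relation.Binary.Subset.Propositional using (_⊆_)
open import Data.List.Relation.Binary.BagAndSetEquality using (_∼[_]_; set)
open import Data.Product using (Σ; _×_; ∃-syntax)

-- Finite subsets of A are represented by lists of elements of A (duplicates
-- and order irrelevant: every notion below is required to respect set
-- equality  _∼[ set ]_  of lists).

-- Data of the statement:
--   R   : binary relation on A
--   con : con i X  means  X ∈ con_i
--   ent : ent i X a  means  X ⊢_i a
module _ {A : Set} (R : A → A → Set) (con : A → List A → Set)
         (ent : A → List A → A → Set) where

  entAll : A → List A → List A → Set
  entAll i X Y = All (ent i X) Y

  -- standing well-formedness: con_i is a set of finite *subsets* (invariant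
  -- under set equality of representing lists), and ⊢_i ⊆ con_i × A
  WellFormed : Set
  WellFormed =
    (∀ i X Y → X ∼[ set ] Y → con i X → con i Y) ×
    (∀ i X a → ent i X a → con i X)

  A4 A5 A8 A9 A10 A11 A7 A12 CondII : Set
  A4 = ∀ i X Y → con i X → entAll i X Y → con i Y
  A5 = ∀ i X Y a → con i X → con i Y → X ⊆ Y → ent i X a → ent i Y a
  A8 = ∀ i j → R i j → ∀ X → con i X → con j X
  A9 = ∀ i j → con j (i ∷ []) → R i j
  A10 = ∀ i j X a → R i j → con i X → ent i X a → ent j X a
  A11 = ∀ i j X a → R i j → con i X → ent j X a → ent i X a
  A7 = ∀ i X a → con i X → ent i X a →
         Σ (List A) λ Z → con i Z × entAll i X Z × ent i Z a
  -- X ⊢_i Y presupposes X ∈ con_i (⊢_i ⊆ con_i × A), made explicit here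
  A12 = ∀ i X Y → con i X → entAll i X Y →
          ∃[ e ] (ent i X e × con e Y)
  CondII = ∀ i X F → con i X → entAll i X F →
             ∃[ j ] Σ (List A) λ Y → con j Y × ent i X j × entAll i X Y × entAll j Y F

-- An element j entailed by a consistent X satisfies j R i, by (A4) on {j} and (A9).
-- This lets (A10)/(A11) move entailments between the entailed "witness" e and i:
-- (A7) iterated over F yields one interpolant Y with X ⊢ᵢ Y ⊢ᵢ F, and (A12) turns
-- Y into a consistent set of some e with X ⊢ᵢ e, to which Y ⊢ᵢ F transfers by (A11).
-- Conversely (II) for F = {a} gives (A7) via (A10), and (A12) follows from (A4).
module Submission where

open import Defs
open import Data.List using (List; _∷_; []; _++_)
open import Data.List.Relation.Unary.All as All using (All; _∷_; [])
open import Data.List.Relation.Unary.All.Properties using (++⁺)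
open import Data.List.Relation.Binary.Subset.Propositional.Properties
  using (xs⊆xs++ys; xs⊆ys++xs)
open import Data.Product using (Σ; _×_; _,_)
open import Function.Bundles using (_⇔_; mk⇔)

module _ {A : Set} (R : A → A → Set) (con : A → List A → Set)
         (ent : A → List A → A → Set) where

  entailed⇒R : A4 R con ent → A9 R con ent →
    ∀ {i X j} → con i X → ent i X j → R j i
  entailed⇒R a4 a9 {i} {X} {j} cX Xj = a9 j i (a4 i X (j ∷ []) cX (Xj ∷ []))

  interpolateAll : A4 R con ent → A5 R con ent → A7 R con ent →
    ∀ i X F → con i X → entAll R con ent i X F →
    Σ (List A) λ Y → con i Y × entAll R con ent i X Y × entAll R con ent i Y F
  interpolateAll a4 a5 a7 i X [] cX [] = [] , a4 i X [] cX [] , [] , []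
  interpolateAll a4 a5 a7 i X (b ∷ F) cX (Xb ∷ XF)
    with a7 i X b cX Xb | interpolateAll a4 a5 a7 i X F cX XF
  ... | Z , cZ , XZ , Zb | Y , cY , XY , YF =
    Z ++ Y , cZY , XZY ,
    a5 i Z (Z ++ Y) b cZ cZY (xs⊆xs++ys Z Y) Zb ∷
    All.map (a5 i Y (Z ++ Y) _ cY cZY (xs⊆ys++xs Y Z)) YF
    where
    XZY = ++⁺ XZ XY
    cZY = a4 i X (Z ++ Y) cX XZY

  A7×A12⇒CondII : A4 R con ent → A5 R con ent → A9 R con ent → A11 R con ent →
    A7 R con ent × A12 R con ent → CondII R con ent
  A7×A12⇒CondII a4 a5 a9 a11 (a7 , a12) i X F cX XF
    with interpolateAll a4 a5 a7 i X F cX XF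
  ... | Y , cY , XY , YF with a12 i X Y cX XY
  ... | e , Xe , ceY =
    e , Y , ceY , Xe , XY , All.map (a11 e i Y _ (entailed⇒R a4 a9 cX Xe) ceY) YF

  CondII⇒A7 : A4 R con ent → A9 R con ent → A10 R con ent →
    CondII R con ent → A7 R con ent
  CondII⇒A7 a4 a9 a10 condII i X a cX Xa with condII i X (a ∷ []) cX (Xa ∷ [])
  ... | j , Y , cjY , Xj , XY , Ya ∷ [] =
    Y , a4 i X Y cX XY , XY , a10 j i Y a (entailed⇒R a4 a9 cX Xj) cjY Ya

  CondII⇒A12 : A4 R con ent → CondII R con ent → A12 R con ent
  CondII⇒A12 a4 condII i X Y cX XY with condII i X Y cX XY
  ... | j , Y′ , cjY′ , Xj , _ , Y′Y = j , Xj , a4 j Y′ Y cjY′ Y′Y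

lemma3p3 : {A : Set} (R : A → A → Set) (con : A → List A → Set)
    (ent : A → List A → A → Set) (Δ : A) →
    WellFormed R con ent →
    A4 R con ent → A5 R con ent → A8 R con ent → A9 R con ent →
    A10 R con ent → A11 R con ent →
    ((A7 R con ent × A12 R con ent) ⇔ CondII R con ent)
lemma3p3 R con ent _ _ a4 a5 _ a9 a10 a11 = mk⇔
  (A7×A12⇒CondII R con ent a4 a5 a9 a11)
  (λ condII → CondII⇒A7 R con ent a4 a9 a10 condII , CondII⇒A12 R con ent a4 condII)
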